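{- Let $n$ be a natural number that is either even or congruent to $7$ or $13$ modulo $18$. Then $n$ can be written as $n = z + q$ with $z$ a Zumkeller number and $q$ a practical number if and only if $n \geq 7$.
   Context: A natural number $n$ is a Zumkeller number if the set of its positive divisors can be partitioned into two subsets with equal sums. A natural number $q$ is practical if every natural number less than or equal to $q$ can be written as a sum of distinct positive divisors of $q$ (in particular $1$ is practical). -}

module Defs where

open import Data.Nat using (ℕ; zero; suc; _+_; _≤_; _≥_; _%_)
open import Data.Nat.Divisibility using (_∣_; _∣?_)
open import Data.List using (List; filter; filterᵇ; upTo; map)
open import Data.Nat.ListAction using (sum)
open import Data.Bool using (Bool; not; T)
open import Data.Product using (∃; _×_)
open import Data.Sum using (_⊎_)
open import Relation.Binary.PropositionalEquality using (_≡_)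
open import Relation.Nullary.Decidable using (does)
open import Function using (_∘_)

divisors : ℕ → List ℕ
divisors n = filter (λ d → d ∣? n) (map suc (upTo n))

Zumkeller : ℕ → Set
Zumkeller n = 1 ≤ n × ∃ λ (c : ℕ → Bool) →
  sum (filterᵇ c (divisors n)) ≡ sum (filterᵇ (not ∘ c) (divisors n))

Practical : ℕ → Set
Practical q = 1 ≤ q × ((m : ℕ) → m ≤ q → ∃ λ (c : ℕ → Bool) →
  sum (filterᵇ c (divisors q)) ≡ m)

ZumkellerPlusPractical : ℕ → Set
ZumkellerPlusPractical n = ∃ λ z → ∃ λ q → Zumkeller z × Practical q × n ≡ z + q

{-# OPTIONS --safe #-}
module Submission where

open import Defs
open import Data.Nat using (ℕ; zero; suc; pred; _+_; _*_; _^_; _%_; _/_; _∸_; _≤_; _<_; _≥_; _≤ᵇ_; _≡ᵇ_; z≤n; s≤s; NonZero; >-nonZero; >-nonZero⁻¹)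
open import Data.Nat.Properties
open import Data.Nat.Induction using (<-rec)
open import Data.Nat.Divisibility
open import Data.Nat.DivMod using (m≡m%n+[m/n]*n; m%n<n; m∣n⇒o%n%m≡o%m)
open import Data.Nat.Coprimality using (Coprime; coprime-divisor)
open import Data.Nat.Primality using (Prime; prime[2]; prime?; prime⇒irreducible; prime⇒nonZero; euclidsLemma)
open import Data.Nat.ListAction using (sum)
open import Data.Nat.ListAction.Properties using (sum-++)
open import Data.Nat.Tactic.RingSolver using (solve-∀)
open import Data.List using (List; []; _∷_; [_]; _++_; map; filter; filterᵇ; upTo; reverse)
open import Data.Bool.ListAction using (any)
open import Data.List.Properties using (applyUpTo-∷ʳ; map-++; map-id)
open import Data.Bool using (Bool; true; false; not; _∨_; if_then_else_)
open import Data.Product using (_×_; _,_; ∃)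
open import Data.Sum using (_⊎_; inj₁; inj₂; map₁)
open import Data.Empty using (⊥-elim)
open import Function using (_∘_)
open import Function.Bundles using (_⇔_; mk⇔)
open import Relation.Nullary using (¬_; Dec; does; yes; no)
open import Relation.Nullary.Decidable using (True; False; toWitness; toWitnessFalse; from-yes; from-no; T?)
open import Relation.Unary using (Pred; Decidable)
open import Relation.Binary.PropositionalEquality using (_≡_; refl; sym; trans; cong; cong₂; subst; subst₂; module ≡-Reasoning)
open import Algebra.Properties.CommutativeSemigroup +-commutativeSemigroup using (interchange)
open ≡-Reasoning

-- The divisor z of a Zumkeller number z lies in one of the two halves of equal sum, so
-- σ(z) ≥ 2z; this excludes z ≤ 5, and with q ≥ 1 gives n ≥ 7. Conversely, the residue of n mod 18
-- yields n = 6k + q with k ≡ 1 or 2 (mod 3) and q ∈ {1, 2, 4, 6, 8, 12, 16}, which are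
-- practical by direct check. For 3 ∤ k write 6k = 2^a·3·m with a ≥ 1 and gcd(m, 6) = 1,
-- so every divisor is 2^i·3·e or 2^i·e with i ≤ a and e ∣ m. Put 2^i·3·e (i < a), e and
-- 2^a·e on one side and the rest on the other. The colour depends only on the 2- and
-- 3-parts, so each side is σ(m) times the corresponding side for 2^a·3, and both of
-- those equal 2^(a+2) − 2.

keepIf : Bool → ℕ → ℕ
keepIf true  x = x
keepIf false x = 0

keepIf-not : ∀ b x → keepIf b x + keepIf (not b) x ≡ x
keepIf-not true  x = +-identityʳ x
keepIf-not false x = refl

keepIf-zero : ∀ b → keepIf b 0 ≡ 0
keepIf-zero true  = refl
keepIf-zero false = refl

keepIf-* : ∀ b k x → keepIf b (k * x) ≡ keepIf b k * x
keepIf-* true  k x = refl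
keepIf-* false k x = refl

keepIf-*ˡ : ∀ b k x → keepIf b (k * x) ≡ k * keepIf b x
keepIf-*ˡ true  k x = refl
keepIf-*ˡ false k x = sym (*-zeroʳ k)

Σ₁ : ℕ → (ℕ → ℕ) → ℕ
Σ₁ zero    f = 0
Σ₁ (suc n) f = Σ₁ n f + f (suc n)

Σ₀ : ℕ → (ℕ → ℕ) → ℕ
Σ₀ n f = Σ₁ n (f ∘ pred)

Σ₁-cong : ∀ n {f g} → (∀ j → 1 ≤ j → j ≤ n → f j ≡ g j) → Σ₁ n f ≡ Σ₁ n g
Σ₁-cong zero    f≗g = refl
Σ₁-cong (suc n) f≗g =
  cong₂ _+_ (Σ₁-cong n (λ j 1≤j j≤n → f≗g j 1≤j (m≤n⇒m≤1+n j≤n))) (f≗g (suc n) (s≤s z≤n) ≤-refl)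

Σ₀-cong : ∀ n {f g} → (∀ i → i < n → f i ≡ g i) → Σ₀ n f ≡ Σ₀ n g
Σ₀-cong n f≗g = Σ₁-cong n λ { (suc i) _ i<n → f≗g i i<n }

Σ₁-zero : ∀ n {f} → (∀ j → 1 ≤ j → j ≤ n → f j ≡ 0) → Σ₁ n f ≡ 0
Σ₁-zero zero    f≗0 = refl
Σ₁-zero (suc n) f≗0 =
  cong₂ _+_ (Σ₁-zero n (λ j 1≤j j≤n → f≗0 j 1≤j (m≤n⇒m≤1+n j≤n))) (f≗0 (suc n) (s≤s z≤n) ≤-refl)

Σ₁-distrib-+ : ∀ n f g → Σ₁ n (λ j → f j + g j) ≡ Σ₁ n f + Σ₁ n g
Σ₁-distrib-+ zero    f g = refl
Σ₁-distrib-+ (suc n) f g = trans (cong (_+ (f (suc n) + g (suc n))) (Σ₁-distrib-+ n f g))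
  (interchange (Σ₁ n f) (Σ₁ n g) (f (suc n)) (g (suc n)))

Σ₁-distribˡ-* : ∀ n k f → Σ₁ n (λ j → k * f j) ≡ k * Σ₁ n f
Σ₁-distribˡ-* zero    k f = sym (*-zeroʳ k)
Σ₁-distribˡ-* (suc n) k f =
  trans (cong (_+ k * f (suc n)) (Σ₁-distribˡ-* n k f)) (sym (*-distribˡ-+ k (Σ₁ n f) (f (suc n))))

Σ₁-distribʳ-* : ∀ n k f → Σ₁ n (λ j → f j * k) ≡ Σ₁ n f * k
Σ₁-distribʳ-* zero    k f = refl
Σ₁-distribʳ-* (suc n) k f =
  trans (cong (_+ f (suc n) * k) (Σ₁-distribʳ-* n k f)) (sym (*-distribʳ-+ k (Σ₁ n f) (f (suc n))))

Σ₁-split : ∀ a b f → Σ₁ (a + b) f ≡ Σ₁ a f + Σ₁ b (λ j → f (a + j))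
Σ₁-split a zero    f = trans (cong (λ n → Σ₁ n f) (+-identityʳ a)) (sym (+-identityʳ _))
Σ₁-split a (suc b) f = begin
  Σ₁ (a + suc b) f                                   ≡⟨ cong (λ n → Σ₁ n f) (+-suc a b) ⟩
  Σ₁ (a + b) f + f (suc (a + b))                     ≡⟨ cong₂ _+_ (Σ₁-split a b f) (cong f (sym (+-suc a b))) ⟩
  Σ₁ a f + Σ₁ b (λ j → f (a + j)) + f (a + suc b)    ≡⟨ +-assoc (Σ₁ a f) _ _ ⟩
  Σ₁ a f + Σ₁ (suc b) (λ j → f (a + j))              ∎

Σ₀-head : ∀ n f → Σ₀ (suc n) f ≡ f 0 + Σ₀ n (f ∘ suc)
Σ₀-head n f = trans (Σ₁-split 1 n (f ∘ pred)) (cong (f 0 +_) (Σ₁-cong n λ { (suc j) _ _ → refl }))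

infix 5 _∣ᵇ_
_∣ᵇ_ : ℕ → ℕ → Bool
d ∣ᵇ n = does (d ∣? n)

∣ᵇ-true : ∀ {d n} → d ∣ n → d ∣ᵇ n ≡ true
∣ᵇ-true {d} {n} d∣n with d ∣? n
... | yes _   = refl
... | no d∤n = ⊥-elim (d∤n d∣n)

∣ᵇ-false : ∀ {d n} → ¬ d ∣ n → d ∣ᵇ n ≡ false
∣ᵇ-false {d} {n} d∤n with d ∣? n
... | yes d∣n = ⊥-elim (d∤n d∣n)
... | no _    = refl

∣ᵇ-cong : ∀ {d n d′ n′} → (d ∣ n → d′ ∣ n′) → (d′ ∣ n′ → d ∣ n) → d ∣ᵇ n ≡ d′ ∣ᵇ n′
∣ᵇ-cong {d} {n} to from with d ∣? n
... | yes d∣n = sym (∣ᵇ-true (to d∣n))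
... | no d∤n  = sym (∣ᵇ-false (d∤n ∘ from))

divisorSum : ℕ → (ℕ → ℕ) → ℕ
divisorSum n h = Σ₁ n (λ d → keepIf (d ∣ᵇ n) (h d))

σ : ℕ → ℕ
σ n = divisorSum n (λ d → d)

sum-map-filter : ∀ {p} {P : Pred ℕ p} (P? : Decidable P) f xs →
  sum (map f (filter P? xs)) ≡ sum (map (λ x → keepIf (does (P? x)) (f x)) xs)
sum-map-filter P? f []       = refl
sum-map-filter P? f (x ∷ xs) with does (P? x)
... | true  = cong (f x +_) (sum-map-filter P? f xs)
... | false = sum-map-filter P? f xs

sum-map-suc-upTo : ∀ g n → sum (map g (map suc (upTo n))) ≡ Σ₁ n g
sum-map-suc-upTo g zero    = refl
sum-map-suc-upTo g (suc n) = begin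
  sum (map g (map suc (upTo (suc n))))
    ≡⟨ cong (λ l → sum (map g (map suc l))) (sym (applyUpTo-∷ʳ (λ x → x) n)) ⟩
  sum (map g (map suc (upTo n ++ [ n ])))
    ≡⟨ cong (λ l → sum (map g l)) (map-++ suc (upTo n) [ n ]) ⟩
  sum (map g (map suc (upTo n) ++ [ suc n ]))
    ≡⟨ cong sum (map-++ g (map suc (upTo n)) [ suc n ]) ⟩
  sum (map g (map suc (upTo n)) ++ [ g (suc n) ])
    ≡⟨ sum-++ (map g (map suc (upTo n))) [ g (suc n) ] ⟩
  sum (map g (map suc (upTo n))) + (g (suc n) + 0)
    ≡⟨ cong₂ _+_ (sum-map-suc-upTo g n) (+-identityʳ _) ⟩
  Σ₁ n g + g (suc n) ∎

sum-filterᵇ-divisors : ∀ c n → sum (filterᵇ c (divisors n)) ≡ divisorSum n (λ d → keepIf (c d) d)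
sum-filterᵇ-divisors c n = begin
  sum (filterᵇ c (filter (_∣? n) candidates))
    ≡⟨ cong sum (sym (map-id (filterᵇ c (filter (_∣? n) candidates)))) ⟩
  sum (map (λ x → x) (filterᵇ c (filter (_∣? n) candidates)))
    ≡⟨ sum-map-filter (T? ∘ c) (λ x → x) (filter (_∣? n) candidates) ⟩
  sum (map (λ d → keepIf (c d) d) (filter (_∣? n) candidates))
    ≡⟨ sum-map-filter (_∣? n) _ candidates ⟩
  sum (map (λ d → keepIf (d ∣ᵇ n) (keepIf (c d) d)) candidates)
    ≡⟨ sum-map-suc-upTo _ n ⟩
  divisorSum n (λ d → keepIf (c d) d) ∎
  where candidates = map suc (upTo n)

divisorSum-cong : ∀ n {h g} → (∀ d → d ∣ n → h d ≡ g d) → divisorSum n h ≡ divisorSum n g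
divisorSum-cong n {h} {g} h≗g = Σ₁-cong n λ d _ _ → on-divisors d
  where
  on-divisors : ∀ d → keepIf (d ∣ᵇ n) (h d) ≡ keepIf (d ∣ᵇ n) (g d)
  on-divisors d with d ∣? n
  ... | yes d∣n = h≗g d d∣n
  ... | no _    = refl

divisorSum-linear : ∀ n k {h} → (∀ d → d ∣ n → h d ≡ k * d) → divisorSum n h ≡ k * σ n
divisorSum-linear n k h≗k* = trans (divisorSum-cong n h≗k*)
  (trans (Σ₁-cong n λ d _ _ → keepIf-*ˡ (d ∣ᵇ n) k d) (Σ₁-distribˡ-* n k _))

divisorSum-extend : ∀ {N M} .{{_ : NonZero N}} h → N ≤ M →
  Σ₁ M (λ d → keepIf (d ∣ᵇ N) (h d)) ≡ divisorSum N h
divisorSum-extend {N} {M} h N≤M = begin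
  Σ₁ M f                                 ≡⟨ cong (λ k → Σ₁ k f) (sym (m+[n∸m]≡n N≤M)) ⟩
  Σ₁ (N + (M ∸ N)) f                     ≡⟨ Σ₁-split N (M ∸ N) f ⟩
  Σ₁ N f + Σ₁ (M ∸ N) (λ j → f (N + j))  ≡⟨ cong (Σ₁ N f +_) (Σ₁-zero (M ∸ N) beyond) ⟩
  Σ₁ N f + 0                             ≡⟨ +-identityʳ _ ⟩
  divisorSum N h                         ∎
  where
  f = λ d → keepIf (d ∣ᵇ N) (h d)
  beyond : ∀ j → 1 ≤ j → j ≤ M ∸ N → f (N + j) ≡ 0
  beyond j 1≤j _ = cong (λ b → keepIf b (h (N + j)))
    (∣ᵇ-false λ N+j∣N → <⇒≱ (m<m+n N 1≤j) (∣⇒≤ N+j∣N))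

Σ₁-multiples : ∀ p .{{_ : NonZero p}} N (f : ℕ → ℕ) →
  Σ₁ (p * N) (λ d → keepIf (p ∣ᵇ d) (f d)) ≡ Σ₁ N (λ e → f (p * e))
Σ₁-multiples p       zero    f = cong (λ k → Σ₁ k (λ d → keepIf (p ∣ᵇ d) (f d))) (*-zeroʳ p)
Σ₁-multiples p@(suc p′) (suc N) f = begin
  Σ₁ (p * suc N) g                          ≡⟨ cong (λ k → Σ₁ k g) p*[1+N] ⟩
  Σ₁ (p * N + p) g                          ≡⟨ Σ₁-split (p * N) p g ⟩
  Σ₁ (p * N) g + Σ₁ p (λ j → g (p * N + j)) ≡⟨ cong₂ _+_ (Σ₁-multiples p N f) block ⟩
  Σ₁ N (λ e → f (p * e)) + f (p * suc N)    ∎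
  where
  g = λ d → keepIf (p ∣ᵇ d) (f d)
  p*[1+N] : p * suc N ≡ p * N + p
  p*[1+N] = trans (*-suc p N) (+-comm p (p * N))
  block : Σ₁ p (λ j → g (p * N + j)) ≡ f (p * suc N)
  block = cong₂ _+_
    (Σ₁-zero p′ λ j 1≤j j≤p′ → cong (λ b → keepIf b (f (p * N + j)))
      (∣ᵇ-false λ p∣pN+j → <⇒≱ (s≤s j≤p′) (∣⇒≤ {{>-nonZero 1≤j}} (∣m+n∣m⇒∣n p∣pN+j (m∣m*n N)))))
    (trans (cong (λ b → keepIf b (f (p * N + p))) (∣ᵇ-true (∣-trans (m∣m*n (suc N)) (∣-reflexive p*[1+N]))))
      (cong f (sym p*[1+N])))

divisorSum-top : ∀ n .{{_ : NonZero n}} h → h n ≤ divisorSum n h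
divisorSum-top (suc n) h = subst (_≤ divisorSum (suc n) h)
  (cong (λ b → keepIf b (h (suc n))) (∣ᵇ-true (∣-refl {suc n})))
  (m≤n+m (keepIf (suc n ∣ᵇ suc n) (h (suc n))) (Σ₁ n (λ d → keepIf (d ∣ᵇ suc n) (h d))))

divisorSum-zero : ∀ n {h} → (∀ d → d ∣ n → h d ≡ 0) → divisorSum n h ≡ 0
divisorSum-zero n h≗0 = trans (divisorSum-cong n h≗0) (Σ₁-zero n λ d _ _ → keepIf-zero (d ∣ᵇ n))

divisorSum-partition : ∀ n (c : ℕ → Bool) h →
  divisorSum n (λ d → keepIf (c d) (h d)) + divisorSum n (λ d → keepIf (not (c d)) (h d)) ≡ divisorSum n h
divisorSum-partition n c h =
  trans (sym (Σ₁-distrib-+ n _ _)) (Σ₁-cong n λ d _ _ → on-divisors (d ∣ᵇ n) (c d) (h d))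
  where
  on-divisors : ∀ b b′ x → keepIf b (keepIf b′ x) + keepIf b (keepIf (not b′) x) ≡ keepIf b x
  on-divisors true  b′ x = keepIf-not b′ x
  on-divisors false b′ x = refl

prime∤⇒coprime : ∀ {p d} → Prime p → ¬ p ∣ d → Coprime d p
prime∤⇒coprime pr p∤d (i∣d , i∣p) with prime⇒irreducible pr i∣p
... | inj₁ i≡1 = i≡1
... | inj₂ refl = ⊥-elim (p∤d i∣d)

divisorSum-prime* : ∀ {p} → Prime p → ∀ N .{{_ : NonZero N}} h →
  divisorSum (p * N) h ≡
  divisorSum N (λ e → h (p * e)) + divisorSum N (λ d → keepIf (not (p ∣ᵇ d)) (h d))
divisorSum-prime* {p} pr N h = begin
  Σ₁ (p * N) g
    ≡⟨ Σ₁-cong (p * N) (λ d _ _ → sym (keepIf-not (p ∣ᵇ d) (g d))) ⟩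
  Σ₁ (p * N) (λ d → keepIf (p ∣ᵇ d) (g d) + keepIf (not (p ∣ᵇ d)) (g d))
    ≡⟨ Σ₁-distrib-+ (p * N) _ _ ⟩
  Σ₁ (p * N) (λ d → keepIf (p ∣ᵇ d) (g d)) + Σ₁ (p * N) (λ d → keepIf (not (p ∣ᵇ d)) (g d))
    ≡⟨ cong₂ _+_ multiples nonMultiples ⟩
  divisorSum N (λ e → h (p * e)) + divisorSum N (λ d → keepIf (not (p ∣ᵇ d)) (h d)) ∎
  where
  instance _ = prime⇒nonZero pr
  g : ℕ → ℕ
  g d = keepIf (d ∣ᵇ p * N) (h d)
  multiples : Σ₁ (p * N) (λ d → keepIf (p ∣ᵇ d) (g d)) ≡ divisorSum N (λ e → h (p * e))
  multiples = trans (Σ₁-multiples p N g) (Σ₁-cong N λ e _ _ →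
    cong (λ b → keepIf b (h (p * e))) (∣ᵇ-cong (*-cancelˡ-∣ p) (*-monoʳ-∣ p)))
  coprimeToP : ∀ d → keepIf (not (p ∣ᵇ d)) (g d) ≡ keepIf (d ∣ᵇ N) (keepIf (not (p ∣ᵇ d)) (h d))
  coprimeToP d with p ∣? d
  ... | yes _  = sym (keepIf-zero (d ∣ᵇ N))
  ... | no p∤d = cong (λ b → keepIf b (h d))
    (∣ᵇ-cong (coprime-divisor (prime∤⇒coprime pr p∤d)) (λ d∣N → ∣-trans d∣N (n∣m*n p)))
  nonMultiples : Σ₁ (p * N) (λ d → keepIf (not (p ∣ᵇ d)) (g d)) ≡
                 divisorSum N (λ d → keepIf (not (p ∣ᵇ d)) (h d))
  nonMultiples = trans (Σ₁-cong (p * N) λ d _ _ → coprimeToP d) (divisorSum-extend _ (m≤n*m N p))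

divisorSum-prime^* : ∀ {p} → Prime p → ∀ {N} → ¬ p ∣ N → .{{_ : NonZero N}} → ∀ a h →
  divisorSum (p ^ a * N) h ≡ Σ₀ (suc a) (λ i → divisorSum N (λ d → h (p ^ i * d)))
divisorSum-prime^* {p} pr {N} p∤N zero h =
  trans (cong (λ n → divisorSum n h) (*-identityˡ N)) (divisorSum-cong N λ d _ → cong h (sym (*-identityˡ d)))
divisorSum-prime^* {p} pr {N} p∤N (suc a) h = begin
  divisorSum (p * p ^ a * N) h
    ≡⟨ cong (λ n → divisorSum n h) (*-assoc p (p ^ a) N) ⟩
  divisorSum (p * (p ^ a * N)) h
    ≡⟨ divisorSum-prime* pr (p ^ a * N) h ⟩
  divisorSum (p ^ a * N) (λ e → h (p * e)) + divisorSum (p ^ a * N) (λ d → keepIf (not (p ∣ᵇ d)) (h d))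
    ≡⟨ cong₂ _+_ (divisorSum-prime^* pr p∤N a _) (divisorSum-prime^* pr p∤N a _) ⟩
  Σ₀ (suc a) (λ i → divisorSum N (λ d → h (p * (p ^ i * d)))) + Σ₀ (suc a) notDivisibleByP
    ≡⟨ cong₂ _+_ (Σ₀-cong (suc a) λ i _ → divisorSum-cong N λ d _ → cong h (sym (*-assoc p (p ^ i) d)))
                 onlyFirstTerm ⟩
  Σ₀ (suc a) (λ i → divisorSum N (λ d → h (p ^ suc i * d))) + divisorSum N (λ d → h (1 * d))
    ≡⟨ +-comm (Σ₀ (suc a) (λ i → divisorSum N (λ d → h (p ^ suc i * d)))) _ ⟩
  divisorSum N (λ d → h (1 * d)) + Σ₀ (suc a) (λ i → divisorSum N (λ d → h (p ^ suc i * d)))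
    ≡⟨ Σ₀-head (suc a) (λ i → divisorSum N (λ d → h (p ^ i * d))) ⟨
  Σ₀ (suc (suc a)) (λ i → divisorSum N (λ d → h (p ^ i * d))) ∎
  where
  instance
    _ = prime⇒nonZero pr
    _ = m*n≢0 (p ^ a) N {{m^n≢0 p a}}
  notDivisibleByP : ℕ → ℕ
  notDivisibleByP i = divisorSum N (λ d → keepIf (not (p ∣ᵇ p ^ i * d)) (h (p ^ i * d)))
  onlyFirstTerm : Σ₀ (suc a) notDivisibleByP ≡ divisorSum N (λ d → h (1 * d))
  onlyFirstTerm = begin
    Σ₀ (suc a) notDivisibleByP
      ≡⟨ Σ₀-head a notDivisibleByP ⟩
    notDivisibleByP 0 + Σ₀ a (notDivisibleByP ∘ suc)
      ≡⟨ cong₂ _+_ (divisorSum-cong N λ d d∣N → cong (λ b → keepIf (not b) (h (1 * d)))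
                      (∣ᵇ-false λ p∣1d → p∤N (∣-trans p∣1d (subst (_∣ N) (sym (*-identityˡ d)) d∣N))))
                   (Σ₁-zero a λ { (suc i) _ _ → divisorSum-zero N λ d _ →
                      cong (λ b → keepIf (not b) (h (p ^ suc i * d)))
                        (∣ᵇ-true {p} (∣-trans (m∣m*n (p ^ i)) (m∣m*n d))) }) ⟩
    divisorSum N (λ d → h (1 * d)) + 0
      ≡⟨ +-identityʳ _ ⟩
    divisorSum N (λ d → h (1 * d)) ∎

prime[3] : Prime 3
prime[3] = from-yes (prime? 3)

2∤3*odd : ∀ {x} → ¬ 2 ∣ x → ¬ 2 ∣ 3 * x
2∤3*odd 2∤x 2∣3x with euclidsLemma 3 _ prime[2] 2∣3x
... | inj₁ 2∣3 = from-no (2 ∣? 3) 2∣3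
... | inj₂ 2∣x = 2∤x 2∣x

3∤2^i : ∀ i → ¬ 3 ∣ 2 ^ i
3∤2^i zero    = from-no (3 ∣? 1)
3∤2^i (suc i) 3∣2^[1+i] with euclidsLemma 2 (2 ^ i) prime[3] 3∣2^[1+i]
... | inj₁ 3∣2   = from-no (3 ∣? 2) 3∣2
... | inj₂ 3∣2^i = 3∤2^i i 3∣2^i

3∤2^i*x : ∀ i {x} → ¬ 3 ∣ x → ¬ 3 ∣ 2 ^ i * x
3∤2^i*x i 3∤x 3∣2^ix with euclidsLemma (2 ^ i) _ prime[3] 3∣2^ix
... | inj₁ 3∣2^i = 3∤2^i i 3∣2^i
... | inj₂ 3∣x   = 3∤x 3∣x

2^a∤2^i*odd : ∀ {i a x} → ¬ 2 ∣ x → i < a → ¬ 2 ^ a ∣ 2 ^ i * x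
2^a∤2^i*odd {zero}  {suc a} {x} 2∤x _ 2^[1+a]∣1x =
  2∤x (∣-trans (m∣m*n (2 ^ a)) (subst (2 ^ suc a ∣_) (*-identityˡ x) 2^[1+a]∣1x))
2^a∤2^i*odd {suc i} {suc a} {x} 2∤x (s≤s i<a) 2^[1+a]∣2^[1+i]x =
  2^a∤2^i*odd 2∤x i<a (*-cancelˡ-∣ 2 (subst (2 * 2 ^ a ∣_) (*-assoc 2 (2 ^ i) x) 2^[1+a]∣2^[1+i]x))

divisorSum-2^a*3*m : ∀ {m} → ¬ 2 ∣ m → ¬ 3 ∣ m → .{{_ : NonZero m}} → ∀ a h →
  divisorSum (2 ^ a * (3 * m)) h ≡
  Σ₀ (suc a) (λ i → divisorSum m (λ e → h (2 ^ i * (3 * e))) + divisorSum m (λ e → h (2 ^ i * e)))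
divisorSum-2^a*3*m {m} 2∤m 3∤m a h =
  trans (divisorSum-prime^* prime[2] (2∤3*odd 2∤m) {{m*n≢0 3 m}} a h) (Σ₀-cong (suc a) λ i _ →
    trans (divisorSum-prime* prime[3] m (λ d → h (2 ^ i * d)))
          (cong (divisorSum m (λ e → h (2 ^ i * (3 * e))) +_) (divisorSum-cong m λ d d∣m →
            cong (λ b → keepIf (not b) (h (2 ^ i * d))) (∣ᵇ-false λ 3∣d → 3∤m (∣-trans 3∣d d∣m)))))

colour : ℕ → ℕ → Bool
colour a d = if 3 ∣ᵇ d then not (2 ^ a ∣ᵇ d) else ((2 ^ a ∣ᵇ d) ∨ not (2 ∣ᵇ d))

-- The sum of the divisors 2^i·3 and 2^i of 2^(b+1)·3 whose colour is sent to true by f,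
-- grouped as i = 0, 1 ≤ i ≤ b and i = b + 1.
weight : ℕ → (Bool → Bool) → ℕ
weight b f = (keepIf (f true) 3 + keepIf (f true) 1)
           + Σ₀ b (λ i → keepIf (f true) (2 ^ suc i * 3) + keepIf (f false) (2 ^ suc i))
           + (keepIf (f false) (2 ^ suc b * 3) + keepIf (f true) (2 ^ suc b))

Σ₀-2^[1+i] : ∀ b → Σ₀ b (λ i → 2 ^ suc i) + 2 ≡ 2 ^ suc b
Σ₀-2^[1+i] zero    = refl
Σ₀-2^[1+i] (suc b) = begin
  Σ₀ b (λ i → 2 ^ suc i) + 2 ^ suc b + 2   ≡⟨ +-assoc (Σ₀ b (λ i → 2 ^ suc i)) (2 ^ suc b) 2 ⟩
  Σ₀ b (λ i → 2 ^ suc i) + (2 ^ suc b + 2) ≡⟨ cong (Σ₀ b (λ i → 2 ^ suc i) +_) (+-comm (2 ^ suc b) 2) ⟩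
  Σ₀ b (λ i → 2 ^ suc i) + (2 + 2 ^ suc b) ≡⟨ +-assoc (Σ₀ b (λ i → 2 ^ suc i)) 2 (2 ^ suc b) ⟨
  Σ₀ b (λ i → 2 ^ suc i) + 2 + 2 ^ suc b   ≡⟨ cong (_+ 2 ^ suc b) (Σ₀-2^[1+i] b) ⟩
  2 ^ suc b + 2 ^ suc b                    ≡⟨ cong (2 ^ suc b +_) (+-identityʳ (2 ^ suc b)) ⟨
  2 ^ suc (suc b)                          ∎

weight-balanced : ∀ b → weight b (λ x → x) ≡ weight b not
weight-balanced b = begin
  4 + Σ₀ b (λ i → 2 ^ suc i * 3 + 0) + 2 ^ suc b
    ≡⟨ cong₂ (λ s t → 4 + s + t) middle (sym (Σ₀-2^[1+i] b)) ⟩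
  4 + 3 * w + (w + 2)
    ≡⟨ rearrange w ⟩
  w + ((w + 2) * 3 + 0)
    ≡⟨ cong (λ t → w + (t * 3 + 0)) (Σ₀-2^[1+i] b) ⟩
  w + (2 ^ suc b * 3 + 0)  ∎
  where
  w = Σ₀ b (λ i → 2 ^ suc i)
  rearrange : ∀ w → 4 + 3 * w + (w + 2) ≡ w + ((w + 2) * 3 + 0)
  rearrange = solve-∀
  middle : Σ₀ b (λ i → 2 ^ suc i * 3 + 0) ≡ 3 * w
  middle = trans (Σ₀-cong b λ i _ → trans (+-identityʳ _) (*-comm (2 ^ suc i) 3)) (Σ₁-distribˡ-* b 3 _)

colour-eval : ∀ {a d t₃ t₂ᵃ t₂} → 3 ∣ᵇ d ≡ t₃ → 2 ^ a ∣ᵇ d ≡ t₂ᵃ → 2 ∣ᵇ d ≡ t₂ →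
  colour a d ≡ (if t₃ then not t₂ᵃ else (t₂ᵃ ∨ not t₂))
colour-eval refl refl refl = refl

module ColouredDivisorSum {m} (2∤m : ¬ 2 ∣ m) (3∤m : ¬ 3 ∣ m) .{{_ : NonZero m}} (b : ℕ) where

  a : ℕ
  a = suc b

  2∤ : ∀ {e} → e ∣ m → ¬ 2 ∣ e
  2∤ e∣m 2∣e = 2∤m (∣-trans 2∣e e∣m)

  3∤ : ∀ {e} → e ∣ m → ¬ 3 ∣ e
  3∤ e∣m 3∣e = 3∤m (∣-trans 3∣e e∣m)

  colour-2^i*3e : ∀ {i e} → i < a → e ∣ m → colour a (2 ^ i * (3 * e)) ≡ true
  colour-2^i*3e {i} {e} i<a e∣m =
    colour-eval {a} {2 ^ i * (3 * e)} (∣ᵇ-true (∣-trans (m∣m*n {3} e) (n∣m*n (2 ^ i))))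
      (∣ᵇ-false (2^a∤2^i*odd (2∤3*odd (2∤ e∣m)) i<a)) refl

  colour-2^a*3e : ∀ {e} → colour a (2 ^ a * (3 * e)) ≡ false
  colour-2^a*3e {e} = colour-eval {a} {2 ^ a * (3 * e)} (∣ᵇ-true (∣-trans (m∣m*n {3} e) (n∣m*n (2 ^ a))))
    (∣ᵇ-true (m∣m*n {2 ^ a} (3 * e))) refl

  colour-e : ∀ {e} → e ∣ m → colour a (1 * e) ≡ true
  colour-e {e} e∣m = colour-eval {a} {1 * e} (∣ᵇ-false (3∤2^i*x 0 (3∤ e∣m)))
    (∣ᵇ-false (2^a∤2^i*odd {0} {a} (2∤ e∣m) (s≤s z≤n)))
    (∣ᵇ-false (2∤ e∣m ∘ subst (2 ∣_) (*-identityˡ e)))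

  colour-2^[1+i]*e : ∀ {i e} → suc i < a → e ∣ m → colour a (2 ^ suc i * e) ≡ false
  colour-2^[1+i]*e {i} {e} 1+i<a e∣m =
    colour-eval {a} {2 ^ suc i * e} (∣ᵇ-false (3∤2^i*x (suc i) (3∤ e∣m)))
    (∣ᵇ-false (2^a∤2^i*odd (2∤ e∣m) 1+i<a)) (∣ᵇ-true (∣-trans (m∣m*n {2} (2 ^ i)) (m∣m*n {2 ^ suc i} e)))

  colour-2^a*e : ∀ {e} → e ∣ m → colour a (2 ^ a * e) ≡ true
  colour-2^a*e {e} e∣m =
    colour-eval {a} {2 ^ a * e} (∣ᵇ-false (3∤2^i*x a (3∤ e∣m))) (∣ᵇ-true (m∣m*n {2 ^ a} e)) refl

  layer : (Bool → Bool) → ℕ → ℕ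
  layer f i = divisorSum m (λ e → keepIf (f (colour a (2 ^ i * (3 * e)))) (2 ^ i * (3 * e)))
            + divisorSum m (λ e → keepIf (f (colour a (2 ^ i * e))) (2 ^ i * e))

  uniform : ∀ (f : Bool → Bool) {β} k (φ : ℕ → ℕ) →
    (∀ e → φ e ≡ k * e) → (∀ {e} → e ∣ m → colour a (φ e) ≡ β) →
    divisorSum m (λ e → keepIf (f (colour a (φ e))) (φ e)) ≡ keepIf (f β) k * σ m
  uniform f {β} k φ φ≡k* colour≡β = divisorSum-linear m (keepIf (f β) k) λ e e∣m →
    trans (cong₂ (λ c x → keepIf (f c) x) (colour≡β e∣m) (φ≡k* e)) (keepIf-* (f β) k e)

  2^i*3*e : ∀ i e → 2 ^ i * (3 * e) ≡ 2 ^ i * 3 * e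
  2^i*3*e i e = sym (*-assoc (2 ^ i) 3 e)

  layer-0 : ∀ f → layer f 0 ≡ (keepIf (f true) 3 + keepIf (f true) 1) * σ m
  layer-0 f = trans
    (cong₂ _+_ (uniform f 3 (λ e → 1 * (3 * e)) (2^i*3*e 0) (colour-2^i*3e (s≤s z≤n)))
               (uniform f 1 (λ e → 1 * e) (λ _ → refl) colour-e))
    (sym (*-distribʳ-+ (σ m) (keepIf (f true) 3) _))

  layer-middle : ∀ f i → suc i < a →
    layer f (suc i) ≡ (keepIf (f true) (2 ^ suc i * 3) + keepIf (f false) (2 ^ suc i)) * σ m
  layer-middle f i 1+i<a = trans
    (cong₂ _+_ (uniform f (2 ^ suc i * 3) (λ e → 2 ^ suc i * (3 * e)) (2^i*3*e (suc i)) (colour-2^i*3e 1+i<a))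
               (uniform f (2 ^ suc i) (λ e → 2 ^ suc i * e) (λ _ → refl) (colour-2^[1+i]*e 1+i<a)))
    (sym (*-distribʳ-+ (σ m) (keepIf (f true) (2 ^ suc i * 3)) _))

  layer-top : ∀ f → layer f a ≡ (keepIf (f false) (2 ^ a * 3) + keepIf (f true) (2 ^ a)) * σ m
  layer-top f = trans
    (cong₂ _+_ (uniform f (2 ^ a * 3) (λ e → 2 ^ a * (3 * e)) (2^i*3*e a) (λ {e} _ → colour-2^a*3e {e}))
               (uniform f (2 ^ a) (λ e → 2 ^ a * e) (λ _ → refl) colour-2^a*e))
    (sym (*-distribʳ-+ (σ m) (keepIf (f false) (2 ^ a * 3)) _))

  colouredSum : ∀ f → divisorSum (2 ^ a * (3 * m)) (λ d → keepIf (f (colour a d)) d) ≡ weight b f * σ m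
  colouredSum f = begin
    divisorSum (2 ^ a * (3 * m)) (λ d → keepIf (f (colour a d)) d)
      ≡⟨ divisorSum-2^a*3*m 2∤m 3∤m a _ ⟩
    Σ₀ a (layer f) + layer f a
      ≡⟨ cong (_+ layer f a) (Σ₀-head b (layer f)) ⟩
    layer f 0 + Σ₀ b (layer f ∘ suc) + layer f a
      ≡⟨ cong₂ _+_ (cong₂ _+_ (layer-0 f) middleLayers) (layer-top f) ⟩
    w₀ * σ m + wₘ * σ m + wₐ * σ m
      ≡⟨ cong (_+ wₐ * σ m) (*-distribʳ-+ (σ m) w₀ wₘ) ⟨
    (w₀ + wₘ) * σ m + wₐ * σ m
      ≡⟨ *-distribʳ-+ (σ m) (w₀ + wₘ) wₐ ⟨
    weight b f * σ m ∎
    where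
    w₀ = keepIf (f true) 3 + keepIf (f true) 1
    wₘ = Σ₀ b (λ i → keepIf (f true) (2 ^ suc i * 3) + keepIf (f false) (2 ^ suc i))
    wₐ = keepIf (f false) (2 ^ a * 3) + keepIf (f true) (2 ^ a)
    middleLayers : Σ₀ b (layer f ∘ suc) ≡ wₘ * σ m
    middleLayers = trans (Σ₀-cong b λ i i<b → layer-middle f i (s≤s i<b)) (Σ₁-distribʳ-* b (σ m) _)

  zumkeller : Zumkeller (2 ^ a * (3 * m))
  zumkeller = >-nonZero⁻¹ N {{m*n≢0 (2 ^ a) (3 * m) {{m^n≢0 2 a}} {{m*n≢0 3 m}}}} , colour a , (begin
    sum (filterᵇ (colour a) (divisors N))             ≡⟨ sum-filterᵇ-divisors (colour a) N ⟩
    divisorSum N (λ d → keepIf (colour a d) d)        ≡⟨ colouredSum (λ x → x) ⟩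
    weight b (λ x → x) * σ m                          ≡⟨ cong (_* σ m) (weight-balanced b) ⟩
    weight b not * σ m                                ≡⟨ colouredSum not ⟨
    divisorSum N (λ d → keepIf (not (colour a d)) d)  ≡⟨ sum-filterᵇ-divisors (not ∘ colour a) N ⟨
    sum (filterᵇ (not ∘ colour a) (divisors N))       ∎)
    where N = 2 ^ a * (3 * m)

odd⇒nonZero : ∀ {m} → ¬ 2 ∣ m → NonZero m
odd⇒nonZero {zero}  2∤0 = ⊥-elim (2∤0 (2 ∣0))
odd⇒nonZero {suc m} _   = _

2-adic : ∀ k → 1 ≤ k → ∃ λ b → ∃ λ m → ¬ 2 ∣ m × k ≡ 2 ^ b * m
2-adic = <-rec _ split
  where
  split : ∀ k → (∀ {j} → j < k → 1 ≤ j → ∃ λ b → ∃ λ m → ¬ 2 ∣ m × j ≡ 2 ^ b * m) →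
          1 ≤ k → ∃ λ b → ∃ λ m → ¬ 2 ∣ m × k ≡ 2 ^ b * m
  split k rec 1≤k with 2 ∣? k
  ... | no 2∤k = 0 , k , 2∤k , sym (*-identityˡ k)
  ... | yes (divides j@(suc _) refl) with rec (m<m*n j 2 (s≤s (s≤s z≤n))) (s≤s z≤n)
  ...   | b , m , 2∤m , j≡2^bm = suc b , m , 2∤m , (begin
    j * 2           ≡⟨ *-comm j 2 ⟩
    2 * j           ≡⟨ cong (2 *_) j≡2^bm ⟩
    2 * (2 ^ b * m) ≡⟨ *-assoc 2 (2 ^ b) m ⟨
    2 ^ suc b * m   ∎)

zumkeller-6k : ∀ {k} → ¬ 3 ∣ k → 1 ≤ k → Zumkeller (6 * k)
zumkeller-6k {k} 3∤k 1≤k with 2-adic k 1≤k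
... | b , m , 2∤m , k≡2^bm = subst Zumkeller (sym 6k≡2^[1+b]*3m)
  (ColouredDivisorSum.zumkeller 2∤m (3∤k ∘ λ 3∣m → subst (3 ∣_) (sym k≡2^bm) (∣-trans 3∣m (n∣m*n (2 ^ b))))
    {{odd⇒nonZero 2∤m}} b)
  where
  6k≡2^[1+b]*3m : 6 * k ≡ 2 ^ suc b * (3 * m)
  6k≡2^[1+b]*3m = trans (cong (6 *_) k≡2^bm) (regroup (2 ^ b) m)
    where
    regroup : ∀ x m → 6 * (x * m) ≡ 2 * x * (3 * m)
    regroup = solve-∀

deficient⇒¬zumkeller : ∀ {n} → σ n < 2 * n → ¬ Zumkeller n
deficient⇒¬zumkeller {n} σn<2n (1≤n , c , sides≡) =
  <⇒≱ σn<2n (subst₂ _≤_ (cong (n +_) (sym (+-identityʳ n))) A+A≡σn (+-mono-≤ n≤A n≤A))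
  where
  instance _ = >-nonZero 1≤n
  A = divisorSum n (λ d → keepIf (c d) d)
  B = divisorSum n (λ d → keepIf (not (c d)) d)
  A≡B : A ≡ B
  A≡B = trans (sym (sum-filterᵇ-divisors c n)) (trans sides≡ (sum-filterᵇ-divisors (not ∘ c) n))
  A+A≡σn : A + A ≡ σ n
  A+A≡σn = trans (cong (A +_) A≡B) (divisorSum-partition n c (λ d → d))
  n≤A : n ≤ A
  n≤A with c n | divisorSum-top n (λ d → keepIf (c d) d) | divisorSum-top n (λ d → keepIf (not (c d)) d)
  ... | true  | n≤A′ | _   = n≤A′
  ... | false | _    | n≤B = subst (n ≤_) (sym A≡B) n≤B

zumkeller⇒6≤ : ∀ {z} → Zumkeller z → 6 ≤ z
zumkeller⇒6≤ {0} (() , _)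
zumkeller⇒6≤ {1} = ⊥-elim ∘ deficient⇒¬zumkeller (s≤s (s≤s z≤n))
zumkeller⇒6≤ {2} = ⊥-elim ∘ deficient⇒¬zumkeller (from-yes (σ 2 <? 4))
zumkeller⇒6≤ {3} = ⊥-elim ∘ deficient⇒¬zumkeller (from-yes (σ 3 <? 6))
zumkeller⇒6≤ {4} = ⊥-elim ∘ deficient⇒¬zumkeller (from-yes (σ 4 <? 8))
zumkeller⇒6≤ {5} = ⊥-elim ∘ deficient⇒¬zumkeller (from-yes (σ 5 <? 10))
zumkeller⇒6≤ {suc (suc (suc (suc (suc (suc _)))))} _ = s≤s (s≤s (s≤s (s≤s (s≤s (s≤s z≤n)))))

greedy : List ℕ → ℕ → List ℕ
greedy []       m = []
greedy (d ∷ ds) m = if d ≤ᵇ m then d ∷ greedy ds (m ∸ d) else greedy ds m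

greedyColour : ℕ → ℕ → ℕ → Bool
greedyColour q m d = any (d ≡ᵇ_) (greedy (reverse (divisors q)) m)

greedy-represents? : ∀ q → Dec (∀ {m} → m < suc q → sum (filterᵇ (greedyColour q m) (divisors q)) ≡ m)
greedy-represents? q = allUpTo? (λ m → sum (filterᵇ (greedyColour q m) (divisors q)) ≟ m) (suc q)

practical : ∀ q .{{_ : NonZero q}} → {True (greedy-represents? q)} → Practical q
practical q {greedy-works} = >-nonZero⁻¹ q , λ m m≤q → greedyColour q m , toWitness greedy-works (s≤s m≤q)

zumkellerPlusPractical-6j+q+18t : ∀ t j q .{{_ : NonZero j}} → {False (3 ∣? j)} → Practical q →
  ZumkellerPlusPractical (6 * j + q + t * 18)
zumkellerPlusPractical-6j+q+18t t j q {3∤j} practical-q =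
  6 * (3 * t + j) , q , zumkeller-6k 3∤3t+j (≤-trans (>-nonZero⁻¹ j) (m≤n+m j (3 * t))) , practical-q , regroup t j q
  where
  3∤3t+j : ¬ 3 ∣ 3 * t + j
  3∤3t+j 3∣3t+j = toWitnessFalse 3∤j (∣m+n∣m⇒∣n 3∣3t+j (m∣m*n t))
  regroup : ∀ t j q → 6 * j + q + t * 18 ≡ 6 * (3 * t + j) + q
  regroup = solve-∀

evenResidue : ∀ r t → r < 18 → r % 2 ≡ 0 → 7 ≤ r + t * 18 → ZumkellerPlusPractical (r + t * 18)
evenResidue 0  (suc t) _ _ _ = zumkellerPlusPractical-6j+q+18t t 2 6  (practical 6)
evenResidue 2  (suc t) _ _ _ = zumkellerPlusPractical-6j+q+18t t 2 8  (practical 8)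
evenResidue 4  (suc t) _ _ _ = zumkellerPlusPractical-6j+q+18t t 1 16 (practical 16)
evenResidue 6  (suc t) _ _ _ = zumkellerPlusPractical-6j+q+18t t 2 12 (practical 12)
evenResidue 8  t       _ _ _ = zumkellerPlusPractical-6j+q+18t t 1 2  (practical 2)
evenResidue 10 t       _ _ _ = zumkellerPlusPractical-6j+q+18t t 1 4  (practical 4)
evenResidue 12 t       _ _ _ = zumkellerPlusPractical-6j+q+18t t 1 6  (practical 6)
evenResidue 14 t       _ _ _ = zumkellerPlusPractical-6j+q+18t t 2 2  (practical 2)
evenResidue 16 t       _ _ _ = zumkellerPlusPractical-6j+q+18t t 2 4  (practical 4)
evenResidue 2  zero    _ _ (s≤s (s≤s ()))
evenResidue 4  zero    _ _ (s≤s (s≤s (s≤s (s≤s ()))))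
evenResidue 6  zero    _ _ (s≤s (s≤s (s≤s (s≤s (s≤s (s≤s ()))))))
evenResidue (suc (suc (suc (suc (suc (suc (suc (suc (suc (suc (suc (suc (suc (suc (suc (suc (suc (suc r)))))))))))))))))) _ r<18 _ _ =
  ⊥-elim (<⇒≱ r<18 (m≤m+n 18 r))

admissibleResidue : ∀ r t → r < 18 → r % 2 ≡ 0 ⊎ r ≡ 7 ⊎ r ≡ 13 → 7 ≤ r + t * 18 →
  ZumkellerPlusPractical (r + t * 18)
admissibleResidue r   t r<18 (inj₁ r%2≡0)       = evenResidue r t r<18 r%2≡0
admissibleResidue .7  t _   (inj₂ (inj₁ refl)) _ = zumkellerPlusPractical-6j+q+18t t 1 1 (practical 1)
admissibleResidue .13 t _   (inj₂ (inj₂ refl)) _ = zumkellerPlusPractical-6j+q+18t t 2 1 (practical 1)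

proposition4p8 : (n : ℕ) → (n % 2 ≡ 0 ⊎ n % 18 ≡ 7 ⊎ n % 18 ≡ 13) →
    (ZumkellerPlusPractical n ⇔ n ≥ 7)
proposition4p8 n admissible = mk⇔ atLeast7 decompose
  where
  atLeast7 : ZumkellerPlusPractical n → n ≥ 7
  atLeast7 (z , q , zumkeller-z , (1≤q , _) , n≡z+q) =
    subst (7 ≤_) (sym n≡z+q) (+-mono-≤ (zumkeller⇒6≤ zumkeller-z) 1≤q)
  n≡r+t*18 : n ≡ n % 18 + n / 18 * 18
  n≡r+t*18 = m≡m%n+[m/n]*n n 18
  admissible′ : n % 18 % 2 ≡ 0 ⊎ n % 18 ≡ 7 ⊎ n % 18 ≡ 13
  admissible′ = map₁ (trans (m∣n⇒o%n%m≡o%m 2 18 n (divides 9 refl))) admissible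
  decompose : n ≥ 7 → ZumkellerPlusPractical n
  decompose 7≤n = subst ZumkellerPlusPractical (sym n≡r+t*18)
    (admissibleResidue (n % 18) (n / 18) (m%n<n n 18) admissible′ (subst (7 ≤_) n≡r+t*18 7≤n))
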